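{- As $\mathbb{L}$-species, $\overline{\mathrm{Alt}} = E*\mathrm{Alt}^{\bullet}$, where $\overline{\mathrm{Alt}}$ is the species of odd permutations and $\mathrm{Alt}$ the species of even permutations.
   Context: An $\mathbb{L}$-species assigns to each finite totally ordered set $\ell$ a finite set $F[\ell]$, functorially in order-preserving bijections; isomorphic $\mathbb{L}$-species are written as equal. $\mathrm{Alt}[\ell]$ (resp. $\overline{\mathrm{Alt}}[\ell]$) is the set of even (resp. odd) bijections $\ell\to\ell$. $E$: one structure on every set; $X$: one structure on each one-element set only. Pointing: $F^{\bullet}[\ell]=F[\ell]\times\ell$. Ordinal product $(F\odot G)[\ell]=\bigsqcup_{\ell=\ell_1\oplus\ell_2}F[\ell_1]\times G[\ell_2]$ over splittings of $\ell$ into an initial segment $\ell_1$ and terminal segment $\ell_2$; convolution $F*G=F\odot X\odot G$. -}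

module Defs where

open import Data.Nat using (ℕ; zero; suc; _+_; _<ᵇ_)
open import Data.Nat.Base using (_%_)
open import Data.Bool using (Bool; true; false; T; _∧_; not; if_then_else_)
open import Data.Fin using (Fin; toℕ; _≟_)
open import Data.Vec using (Vec; []; _∷_)
open import Data.Unit using (⊤)
open import Data.Product using (Σ; _×_)
open import Relation.Binary.PropositionalEquality using (_≡_)
open import Relation.Nullary.Decidable using (⌊_⌋)
open import Function.Bundles using (_↔_)

-- Every finite totally ordered set is uniquely (order-)
-- isomorphic to the standard ordinal {0 < 1 < … < n-1} = Fin n, and the
-- only order-preserving bijection of a finite total order to itself is
-- the identity.  Hence an L-species is determined (up to isomorphism)
-- by its values on the standard ordinals, i.e. by a family ℕ → Set, and
-- an isomorphism of L-species is a family of bijections F[n] ↔ G[n].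

LSpecies : Set₁
LSpecies = ℕ → Set

_≅_ : LSpecies → LSpecies → Set
F ≅ G = (n : ℕ) → F n ↔ G n

E : LSpecies
E n = ⊤

X : LSpecies
X n = n ≡ 1

_• : LSpecies → LSpecies
(F •) n = F n × Fin n

-- ordinal product: splitting ℓ = ℓ₁ ⊕ ℓ₂ of the ordinal of size n into an
-- initial segment of size a and terminal segment of size b (a + b = n)
_⊙_ : LSpecies → LSpecies → LSpecies
(F ⊙ G) n = Σ ℕ λ a → Σ ℕ λ b → (a + b ≡ n) × F a × G b

infixl 7 _⊙_
infixl 6 _⋆_

_⋆_ : LSpecies → LSpecies → LSpecies
F ⋆ G = F ⊙ X ⊙ G

-- Permutations of the ordinal Fin n, encoded as the word
-- (σ(0), σ(1), …, σ(n-1)) : Vec (Fin n) n whose entries are pairwise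
-- distinct (which, for a map Fin n → Fin n, is exactly bijectivity).

notIn : ∀ {n m} → Fin n → Vec (Fin n) m → Bool
notIn x [] = true
notIn x (y ∷ ys) = not ⌊ x ≟ y ⌋ ∧ notIn x ys

distinct : ∀ {n m} → Vec (Fin n) m → Bool
distinct [] = true
distinct (x ∷ xs) = notIn x xs ∧ distinct xs

countBelow : ∀ {n m} → Fin n → Vec (Fin n) m → ℕ
countBelow x [] = 0
countBelow x (y ∷ ys) =
  (if toℕ y <ᵇ toℕ x then 1 else 0) + countBelow x ys

inversions : ∀ {n m} → Vec (Fin n) m → ℕ
inversions [] = 0
inversions (x ∷ xs) = countBelow x xs + inversions xs

isEven : ∀ {n m} → Vec (Fin n) m → Bool
isEven v = inversions v % 2 Data.Nat.≡ᵇ 0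

Alt : LSpecies
Alt n = Σ (Vec (Fin n) n) λ σ → T (distinct σ ∧ isEven σ)

AltOdd : LSpecies
AltOdd n = Σ (Vec (Fin n) n) λ σ → T (distinct σ ∧ not (isEven σ))

-- An odd permutation of {0, …, m} is its first letter x followed by a permutation τ of
-- {0, …, m - 1} relabelled around x.  For x = 0 the relabelling is a shift, so τ is odd.
-- For x = k + 1, swapping the first two letters of τ flips the parity of τ and of x τ alike,
-- so sending τ to whichever of τ and its swap is even is a bijection from the τ with x τ odd
-- onto Alt[m].  Hence Alt‾[m + 1] ≅ Alt‾[m] + Alt•[m] and Alt‾[0] = ∅, the recursion that
-- characterises E ⋆ Alt•.

module Submission where

open import Defs
open import Data.Bool using (Bool; true; false; T; _∧_; not; if_then_else_)
open import Data.Bool.Properties using (T-≡; T-∧; T-irrelevant; not-involutive)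
open import Data.Empty using (⊥)
open import Data.Fin using (Fin; zero; suc; toℕ; punchIn; punchOut)
open import Data.Fin.Properties using (toℕ-injective; punchIn-injective; punchInᵢ≢i; punchOut-cong; punchOut-punchIn; punchIn-punchOut)
open import Data.Nat using (ℕ; zero; suc; _+_; _<ᵇ_; _%_; _≡ᵇ_)
open import Data.Nat.Properties using (+-assoc; +-comm; ≡-irrelevant; suc-injective)
open import Data.Product using (Σ; Σ-syntax; _×_; _,_; proj₁; proj₂)
open import Data.Product.Algebra using (Σ-assoc; ×-comm; ×-cong)
open import Data.Product.Function.Dependent.Propositional using (Σ-↔)
open import Data.Sum using (_⊎_; inj₁; inj₂)
open import Data.Sum.Function.Propositional using (_⊎-↔_)
open import Data.Unit using (tt)
open import Data.Vec using (Vec; []; _∷_; _++_; map)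
open import Function using (_∘_; Equivalence)
open import Function.Bundles using (_↔_; mk↔ₛ′)
open import Function.Properties.Inverse using (↔-refl; ↔-sym; ↔-trans)
import Function.Related.Propositional as Related
open import Relation.Binary.PropositionalEquality using (_≡_; _≢_; refl; sym; trans; cong; cong₂; subst; module ≡-Reasoning)
open import Relation.Nullary.Decidable using (toWitnessFalse; fromWitnessFalse)

open Equivalence using (to; from)

Σ-T-≡ : ∀ {A : Set} {P : A → Bool} {a a′ : A} {p : T (P a)} {p′ : T (P a′)} →
        a ≡ a′ → _≡_ {A = Σ A (T ∘ P)} (a , p) (a′ , p′)
Σ-T-≡ refl = cong (_ ,_) (T-irrelevant _ _)

Σ-T-∧-↔ : ∀ {A : Set} (P Q : A → Bool) → (Σ[ a ∈ A ] T (P a ∧ Q a)) ↔ (Σ[ a ∈ Σ A (T ∘ P) ] T (Q (proj₁ a)))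
Σ-T-∧-↔ P Q = mk↔ₛ′
  (λ (a , pq) → let p , q = to T-∧ pq in (a , p) , q)
  (λ ((a , p) , q) → a , from T-∧ (p , q))
  (λ _ → Σ-T-≡ (Σ-T-≡ refl))
  (λ _ → Σ-T-≡ refl)

Σ-Fin-suc-↔ : ∀ {n} (B : Fin (suc n) → Set) → Σ (Fin (suc n)) B ↔ (B zero ⊎ Σ (Fin n) (B ∘ suc))
Σ-Fin-suc-↔ B = mk↔ₛ′ split join
  (λ { (inj₁ _) → refl ; (inj₂ _) → refl })
  (λ { (zero , _) → refl ; (suc _ , _) → refl })
  where
  split : Σ _ B → B zero ⊎ Σ _ (B ∘ suc)
  split (zero , b) = inj₁ b
  split (suc k , b) = inj₂ (k , b)
  join : B zero ⊎ Σ _ (B ∘ suc) → Σ _ B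
  join (inj₁ b) = zero , b
  join (inj₂ (k , b)) = suc k , b

module _ {A : Set} (f : A → A) where

  Flips : (A → Bool) → (A → Bool) → Set
  Flips P Q = ∀ a → P a ≡ not (Q a) → P (f a) ≡ not (P a) × Q (f a) ≡ not (Q a)

  private
    select : (A → Bool) → A → A
    select Q a = if Q a then a else f a

    flips-sym : ∀ {P Q} → Flips P Q → Flips Q P
    flips-sym {P} {Q} flips a Q≡¬P =
      let P-flip , Q-flip = flips a (trans (sym (not-involutive (P a))) (cong not (sym Q≡¬P))) in Q-flip , P-flip

    select-satisfies : ∀ {P Q} → Flips P Q → ∀ {a} → T (P a) → T (Q (select Q a))
    select-satisfies {P} {Q} flips {a} p with Q a in eq
    ... | true = subst T (sym eq) tt
    ... | false = subst T (sym (trans (proj₂ (flips a P≡¬Q)) (cong not eq))) tt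
      where
      P≡¬Q : P a ≡ not (Q a)
      P≡¬Q = trans (to T-≡ p) (sym (cong not eq))

  module _ (f-involutive : ∀ a → f (f a) ≡ a) where

    private
      select-select : ∀ {P Q} → Flips P Q → ∀ {a} → T (P a) → select P (select Q a) ≡ a
      select-select {P} {Q} flips {a} p with Q a in eq
      ... | true = cong (if_then a else f a) (to T-≡ p)
      ... | false = trans (cong (if_then f a else f (f a)) P[fa]≡false) (f-involutive a)
        where
        P[fa]≡false : P (f a) ≡ false
        P[fa]≡false = trans (proj₁ (flips a (trans (to T-≡ p) (sym (cong not eq))))) (cong not (to T-≡ p))

    Σ-T-↔-by-involution : ∀ {P Q : A → Bool} → Flips P Q → Σ A (T ∘ P) ↔ Σ A (T ∘ Q)
    Σ-T-↔-by-involution {P} {Q} flips = mk↔ₛ′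
      (λ (a , p) → select Q a , select-satisfies flips p)
      (λ (a , q) → select P a , select-satisfies (flips-sym flips) q)
      (λ (_ , q) → Σ-T-≡ (select-select (flips-sym flips) q))
      (λ (_ , p) → Σ-T-≡ (select-select flips p))

even : ℕ → Bool
even zero = true
even (suc n) = not (even n)

isEven≡even-inversions : ∀ {n m} (v : Vec (Fin n) m) → isEven v ≡ even (inversions v)
isEven≡even-inversions v = %2≡ᵇ0≡even (inversions v)
  where
  %2≡ᵇ0≡even : ∀ k → (k % 2 ≡ᵇ 0) ≡ even k
  %2≡ᵇ0≡even zero = refl
  %2≡ᵇ0≡even (suc zero) = refl
  %2≡ᵇ0≡even (suc (suc k)) = trans (%2≡ᵇ0≡even k) (sym (not-involutive (even k)))

even-+-flip : ∀ c {k l} → even l ≡ not (even k) → even (c + l) ≡ not (even (c + k))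
even-+-flip zero e = e
even-+-flip (suc c) e = cong not (even-+-flip c e)

bit : Bool → ℕ
bit b = if b then 1 else 0

even-bit-not : ∀ b s → even (bit (not b) + s) ≡ not (even (bit b + s))
even-bit-not true s = sym (not-involutive (even s))
even-bit-not false s = refl

<ᵇ-asym : ∀ {x y} → x ≢ y → (x <ᵇ y) ≡ not (y <ᵇ x)
<ᵇ-asym {zero} {zero} x≢y with () ← x≢y refl
<ᵇ-asym {zero} {suc y} _ = refl
<ᵇ-asym {suc x} {zero} _ = refl
<ᵇ-asym {suc x} {suc y} x≢y = <ᵇ-asym (x≢y ∘ cong suc)

+-left-comm : ∀ a b c → a + (b + c) ≡ b + (a + c)
+-left-comm a b c = trans (sym (+-assoc a b c)) (trans (cong (_+ c) (+-comm a b)) (+-assoc b a c))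

+-exchange : ∀ a b c d → (a + b) + (c + d) ≡ a + (c + (b + d))
+-exchange a b c d = trans (+-assoc a b (c + d)) (cong (a +_) (+-left-comm b c d))

module _ {n : ℕ} where

  even-inversions-swapHeads : ∀ {l} (a b : Fin n) (r : Vec (Fin n) l) → a ≢ b →
    even (inversions (b ∷ a ∷ r)) ≡ not (even (inversions (a ∷ b ∷ r)))
  even-inversions-swapHeads a b r a≢b = begin
    even (inversions (b ∷ a ∷ r))
      ≡⟨ cong even (+-exchange (bit (toℕ a <ᵇ toℕ b)) (countBelow b r) (countBelow a r) (inversions r)) ⟩
    even (bit (toℕ a <ᵇ toℕ b) + S)
      ≡⟨ cong (λ q → even (bit q + S)) (<ᵇ-asym (a≢b ∘ toℕ-injective)) ⟩
    even (bit (not (toℕ b <ᵇ toℕ a)) + S)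
      ≡⟨ even-bit-not (toℕ b <ᵇ toℕ a) S ⟩
    not (even (bit (toℕ b <ᵇ toℕ a) + S))
      ≡⟨ cong (not ∘ even) (sym (+-assoc (bit (toℕ b <ᵇ toℕ a)) (countBelow a r) (countBelow b r + inversions r))) ⟩
    not (even (inversions (a ∷ b ∷ r))) ∎
    where
    open ≡-Reasoning
    S : ℕ
    S = countBelow a r + (countBelow b r + inversions r)

  countBelow-transpose : ∀ {k l} (x : Fin n) (u : Vec (Fin n) k) (a b : Fin n) (r : Vec (Fin n) l) →
    countBelow x (u ++ b ∷ a ∷ r) ≡ countBelow x (u ++ a ∷ b ∷ r)
  countBelow-transpose x [] a b r = +-left-comm (bit (toℕ b <ᵇ toℕ x)) (bit (toℕ a <ᵇ toℕ x)) (countBelow x r)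
  countBelow-transpose x (y ∷ u) a b r = cong (bit (toℕ y <ᵇ toℕ x) +_) (countBelow-transpose x u a b r)

  even-inversions-transpose : ∀ {k l} (u : Vec (Fin n) k) (a b : Fin n) (r : Vec (Fin n) l) → a ≢ b →
    even (inversions (u ++ b ∷ a ∷ r)) ≡ not (even (inversions (u ++ a ∷ b ∷ r)))
  even-inversions-transpose [] a b r a≢b = even-inversions-swapHeads a b r a≢b
  even-inversions-transpose (y ∷ u) a b r a≢b
    rewrite countBelow-transpose y u a b r =
      even-+-flip (countBelow y (u ++ a ∷ b ∷ r)) (even-inversions-transpose u a b r a≢b)

  isEven-transpose : ∀ {k l} (u : Vec (Fin n) k) (a b : Fin n) (r : Vec (Fin n) l) → a ≢ b →
    isEven (u ++ b ∷ a ∷ r) ≡ not (isEven (u ++ a ∷ b ∷ r))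
  isEven-transpose u a b r a≢b
    rewrite isEven≡even-inversions (u ++ b ∷ a ∷ r) | isEven≡even-inversions (u ++ a ∷ b ∷ r) =
      even-inversions-transpose u a b r a≢b

countBelow-zero : ∀ {n m} (v : Vec (Fin (suc n)) m) → countBelow zero v ≡ 0
countBelow-zero [] = refl
countBelow-zero (y ∷ v) = countBelow-zero v

countBelow-map-suc : ∀ {n m} (x : Fin n) (v : Vec (Fin n) m) → countBelow (suc x) (map suc v) ≡ countBelow x v
countBelow-map-suc x [] = refl
countBelow-map-suc x (y ∷ v) = cong (bit (toℕ y <ᵇ toℕ x) +_) (countBelow-map-suc x v)

inversions-map-suc : ∀ {n m} (v : Vec (Fin n) m) → inversions (map suc v) ≡ inversions v
inversions-map-suc [] = refl
inversions-map-suc (y ∷ v) = cong₂ _+_ (countBelow-map-suc y v) (inversions-map-suc v)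

isEven-zero∷map-suc : ∀ {n m} (v : Vec (Fin n) m) → isEven (zero ∷ map suc v) ≡ isEven v
isEven-zero∷map-suc v = cong (λ k → k % 2 ≡ᵇ 0) (cong₂ _+_ (countBelow-zero (map suc v)) (inversions-map-suc v))

module _ {n : ℕ} where

  notIn-∷⁻ : ∀ {m} (x y : Fin n) (ys : Vec (Fin n) m) → T (notIn x (y ∷ ys)) → x ≢ y × T (notIn x ys)
  notIn-∷⁻ x y ys p = let h , t = to T-∧ p in toWitnessFalse h , t

  notIn-∷⁺ : ∀ {m} (x y : Fin n) (ys : Vec (Fin n) m) → x ≢ y → T (notIn x ys) → T (notIn x (y ∷ ys))
  notIn-∷⁺ x y ys x≢y t = from T-∧ (fromWitnessFalse x≢y , t)

module _ {n k : ℕ} (f : Fin n → Fin k) where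

  notIn-map⁻ : ∀ {m} (x : Fin n) (ys : Vec (Fin n) m) → T (notIn (f x) (map f ys)) → T (notIn x ys)
  notIn-map⁻ x [] _ = tt
  notIn-map⁻ x (y ∷ ys) p =
    let fx≢fy , t = notIn-∷⁻ (f x) (f y) (map f ys) p in notIn-∷⁺ x y ys (fx≢fy ∘ cong f) (notIn-map⁻ x ys t)

  distinct-map⁻ : ∀ {m} (ys : Vec (Fin n) m) → T (distinct (map f ys)) → T (distinct ys)
  distinct-map⁻ [] _ = tt
  distinct-map⁻ (y ∷ ys) d =
    let y∉ys , d′ = to T-∧ d in from T-∧ (notIn-map⁻ y ys y∉ys , distinct-map⁻ ys d′)

  module _ (f-injective : ∀ {a b} → f a ≡ f b → a ≡ b) where

    notIn-map⁺ : ∀ {m} (x : Fin n) (ys : Vec (Fin n) m) → T (notIn x ys) → T (notIn (f x) (map f ys))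
    notIn-map⁺ x [] _ = tt
    notIn-map⁺ x (y ∷ ys) p =
      let x≢y , t = notIn-∷⁻ x y ys p in notIn-∷⁺ (f x) (f y) (map f ys) (x≢y ∘ f-injective) (notIn-map⁺ x ys t)

    distinct-map⁺ : ∀ {m} (ys : Vec (Fin n) m) → T (distinct ys) → T (distinct (map f ys))
    distinct-map⁺ [] _ = tt
    distinct-map⁺ (y ∷ ys) d =
      let y∉ys , d′ = to T-∧ d in from T-∧ (notIn-map⁺ y ys y∉ys , distinct-map⁺ ys d′)

module _ {n : ℕ} (x : Fin (suc n)) where

  notIn-map-punchIn : ∀ {m} (ys : Vec (Fin n) m) → T (notIn x (map (punchIn x) ys))
  notIn-map-punchIn [] = tt
  notIn-map-punchIn (y ∷ ys) = notIn-∷⁺ x (punchIn x y) (map (punchIn x) ys) (punchInᵢ≢i x y ∘ sym) (notIn-map-punchIn ys)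

  delete : ∀ {m} (xs : Vec (Fin (suc n)) m) → T (notIn x xs) → Vec (Fin n) m
  delete [] _ = []
  delete (y ∷ ys) p = punchOut (proj₁ (notIn-∷⁻ x y ys p)) ∷ delete ys (proj₂ (notIn-∷⁻ x y ys p))

  map-punchIn-delete : ∀ {m} (xs : Vec (Fin (suc n)) m) (p : T (notIn x xs)) → map (punchIn x) (delete xs p) ≡ xs
  map-punchIn-delete [] _ = refl
  map-punchIn-delete (y ∷ ys) p = cong₂ _∷_ (punchIn-punchOut _) (map-punchIn-delete ys _)

  delete-map-punchIn : ∀ {m} (ys : Vec (Fin n) m) (p : T (notIn x (map (punchIn x) ys))) → delete (map (punchIn x) ys) p ≡ ys
  delete-map-punchIn [] _ = refl
  delete-map-punchIn (y ∷ ys) p = cong₂ _∷_ (trans (punchOut-cong x refl) (punchOut-punchIn x)) (delete-map-punchIn ys _)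

Perm : ℕ → Set
Perm n = Σ[ σ ∈ Vec (Fin n) n ] T (distinct σ)

PermWith : ∀ n → (Vec (Fin n) n → Bool) → Set
PermWith n P = Σ[ σ ∈ Perm n ] T (P (proj₁ σ))

Perm-suc-↔ : ∀ {n} → (Fin (suc n) × Perm n) ↔ Perm (suc n)
Perm-suc-↔ = mk↔ₛ′ insert remove
  (λ { (x ∷ xs , _) → Σ-T-≡ (cong (x ∷_) (map-punchIn-delete x xs _)) })
  (λ (x , τ , _) → cong (x ,_) (Σ-T-≡ (delete-map-punchIn x τ _)))
  where
  insert : ∀ {n} → Fin (suc n) × Perm n → Perm (suc n)
  insert (x , τ , d) = x ∷ map (punchIn x) τ ,
    from T-∧ (notIn-map-punchIn x τ , distinct-map⁺ (punchIn x) (punchIn-injective x _ _) τ d)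
  remove : ∀ {n} → Perm (suc n) → Fin (suc n) × Perm n
  remove (x ∷ xs , d) =
    let x∉xs , d′ = to T-∧ d
    in x , delete x xs x∉xs ,
       distinct-map⁻ (punchIn x) (delete x xs x∉xs) (subst (T ∘ distinct) (sym (map-punchIn-delete x xs x∉xs)) d′)

PermWith-suc-↔ : ∀ {n} (P : Vec (Fin (suc n)) (suc n) → Bool) →
  PermWith (suc n) P ↔ (Σ[ x ∈ Fin (suc n) ] PermWith n (λ τ → P (x ∷ map (punchIn x) τ)))
PermWith-suc-↔ P = ↔-trans (↔-sym (Σ-↔ Perm-suc-↔ ↔-refl)) Σ-assoc

PermWith-cong : ∀ {n} {P Q : Vec (Fin n) n → Bool} → (∀ σ → P σ ≡ Q σ) → PermWith n P ↔ PermWith n Q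
PermWith-cong P≗Q = mk↔ₛ′
  (λ (σ , p) → σ , subst T (P≗Q (proj₁ σ)) p)
  (λ (σ , q) → σ , subst T (sym (P≗Q (proj₁ σ))) q)
  (λ _ → Σ-T-≡ refl)
  (λ _ → Σ-T-≡ refl)

swapHeads : ∀ {A : Set} {m} → Vec A m → Vec A m
swapHeads (a ∷ b ∷ r) = b ∷ a ∷ r
swapHeads v = v

swapHeads-involutive : ∀ {A : Set} {m} (v : Vec A m) → swapHeads (swapHeads v) ≡ v
swapHeads-involutive [] = refl
swapHeads-involutive (a ∷ []) = refl
swapHeads-involutive (a ∷ b ∷ r) = refl

module _ {n : ℕ} where

  distinct-swapHeads : ∀ {m} (v : Vec (Fin n) m) → T (distinct v) → T (distinct (swapHeads v))
  distinct-swapHeads [] d = d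
  distinct-swapHeads (a ∷ []) d = d
  distinct-swapHeads (a ∷ b ∷ r) d =
    let a∉b∷r , b∷r-distinct = to T-∧ d
        b∉r , r-distinct = to T-∧ b∷r-distinct
        a≢b , a∉r = notIn-∷⁻ a b r a∉b∷r
    in from T-∧ (notIn-∷⁺ b a r (a≢b ∘ sym) b∉r , from T-∧ (a∉r , r-distinct))

  distinct-heads : ∀ {m} (a b : Fin n) (r : Vec (Fin n) m) → T (distinct (a ∷ b ∷ r)) → a ≢ b
  distinct-heads a b r d = proj₁ (notIn-∷⁻ a b r (proj₁ (to T-∧ d)))

Perm-swapHeads : ∀ {n} → Perm n → Perm n
Perm-swapHeads (σ , d) = swapHeads σ , distinct-swapHeads σ d

Perm-swapHeads-involutive : ∀ {n} (σ : Perm n) → Perm-swapHeads (Perm-swapHeads σ) ≡ σ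
Perm-swapHeads-involutive (σ , _) = Σ-T-≡ (swapHeads-involutive σ)

PermWith-odd-after-suc-↔ : ∀ {n} (k : Fin n) →
  PermWith n (λ τ → not (isEven (suc k ∷ map (punchIn (suc k)) τ))) ↔ PermWith n isEven
PermWith-odd-after-suc-↔ k = Σ-T-↔-by-involution Perm-swapHeads Perm-swapHeads-involutive (swapHeads-flips k)
  where
  swapHeads-flips : ∀ {n} (k : Fin n) →
    Flips Perm-swapHeads (λ σ → not (isEven (suc k ∷ map (punchIn (suc k)) (proj₁ σ)))) (isEven ∘ proj₁)
  -- for n = 1 both predicates hold on the only permutation, so the hypothesis is absurd
  swapHeads-flips zero (zero ∷ [] , _) ()
  swapHeads-flips k (a ∷ b ∷ r , d) _ =
    cong not (isEven-transpose (suc k ∷ []) (punchIn (suc k) a) (punchIn (suc k) b) (map (punchIn (suc k)) r)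
                (a≢b ∘ punchIn-injective (suc k) a b)) ,
    isEven-transpose [] a b r a≢b
    where
    a≢b : a ≢ b
    a≢b = distinct-heads a b r d

AltOdd-zero : AltOdd 0 ↔ ⊥
AltOdd-zero = mk↔ₛ′ (λ { ([] , ()) }) (λ ()) (λ ()) (λ { ([] , ()) })

AltOdd-suc : ∀ m → AltOdd (suc m) ↔ (AltOdd m ⊎ (Alt •) m)
AltOdd-suc m = begin
  AltOdd (suc m)
    ↔⟨ Σ-T-∧-↔ distinct (not ∘ isEven) ⟩
  PermWith (suc m) (not ∘ isEven)
    ↔⟨ PermWith-suc-↔ (not ∘ isEven) ⟩
  (Σ[ x ∈ Fin (suc m) ] PermWith m (λ τ → not (isEven (x ∷ map (punchIn x) τ))))
    ↔⟨ Σ-Fin-suc-↔ _ ⟩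
  (PermWith m (λ τ → not (isEven (zero ∷ map suc τ)))
    ⊎ (Σ[ k ∈ Fin m ] PermWith m (λ τ → not (isEven (suc k ∷ map (punchIn (suc k)) τ)))))
    ↔⟨ PermWith-cong (cong not ∘ isEven-zero∷map-suc) ⊎-↔ Σ-↔ ↔-refl (PermWith-odd-after-suc-↔ _) ⟩
  (PermWith m (not ∘ isEven) ⊎ (Fin m × PermWith m isEven))
    ↔⟨ ↔-sym (Σ-T-∧-↔ distinct (not ∘ isEven)) ⊎-↔ ↔-trans (×-comm _ _) (×-cong (↔-sym (Σ-T-∧-↔ distinct isEven)) ↔-refl) ⟩
  (AltOdd m ⊎ (Alt m × Fin m)) ∎
  where open Related.EquationalReasoning

E⋆′ : LSpecies → LSpecies
E⋆′ G n = Σ[ a ∈ ℕ ] Σ[ c ∈ ℕ ] (suc (a + c) ≡ n) × G c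

E⋆-↔-E⋆′ : ∀ {G} n → (E ⋆ G) n ↔ E⋆′ G n
E⋆-↔-E⋆′ {G} n = mk↔ₛ′ merge split
  (λ (a , c , _ , g) → cong (λ e → a , c , e , g) (≡-irrelevant _ _))
  (λ { (_ , c , _ , (a , _ , refl , _ , refl) , g) → cong (λ e → a + 1 , c , e , (a , 1 , refl , tt , refl) , g) (≡-irrelevant _ _) })
  where
  a+1+c≡1+a+c : ∀ a c → a + 1 + c ≡ suc (a + c)
  a+1+c≡1+a+c a c = cong (_+ c) (+-comm a 1)
  merge : (E ⋆ G) n → E⋆′ G n
  merge (_ , c , e , (a , _ , refl , _ , refl) , g) = a , c , trans (sym (a+1+c≡1+a+c a c)) e , g
  split : E⋆′ G n → (E ⋆ G) n
  split (a , c , e , g) = a + 1 , c , trans (a+1+c≡1+a+c a c) e , (a , 1 , refl , tt , refl) , g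

E⋆′-zero : ∀ {G} → E⋆′ G 0 ↔ ⊥
E⋆′-zero = mk↔ₛ′ (λ ()) (λ ()) (λ ()) (λ ())

E⋆′-suc : ∀ {G} m → E⋆′ G (suc m) ↔ (E⋆′ G m ⊎ G m)
E⋆′-suc {G} m = mk↔ₛ′ split join
  (λ { (inj₁ (a , c , _ , g)) → cong (λ e → inj₁ (a , c , e , g)) (≡-irrelevant _ _) ; (inj₂ _) → refl })
  (λ { (zero , _ , refl , _) → refl ; (suc a , c , _ , g) → cong (λ e → suc a , c , e , g) (≡-irrelevant _ _) })
  where
  split : E⋆′ G (suc m) → E⋆′ G m ⊎ G m
  split (zero , _ , refl , g) = inj₂ g
  split (suc a , c , e , g) = inj₁ (a , c , suc-injective e , g)
  join : E⋆′ G m ⊎ G m → E⋆′ G (suc m)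
  join (inj₁ (a , c , e , g)) = suc a , c , cong suc e , g
  join (inj₂ g) = zero , m , refl , g

≅-E⋆ : ∀ {F G} → F 0 ↔ ⊥ → (∀ m → F (suc m) ↔ (F m ⊎ G m)) → F ≅ (E ⋆ G)
≅-E⋆ {F} {G} F-zero F-suc n = ↔-trans (F-↔-E⋆′ n) (↔-sym (E⋆-↔-E⋆′ n))
  where
  F-↔-E⋆′ : ∀ n → F n ↔ E⋆′ G n
  F-↔-E⋆′ zero = ↔-trans F-zero (↔-sym E⋆′-zero)
  F-↔-E⋆′ (suc m) = ↔-trans (F-suc m) (↔-trans (F-↔-E⋆′ m ⊎-↔ ↔-refl) (↔-sym (E⋆′-suc m)))

corollary2p10 : AltOdd ≅ (E ⋆ (Alt •))
corollary2p10 = ≅-E⋆ AltOdd-zero AltOdd-suc
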